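{- Let $\vdash$ be a regular entailment relation for an ordered group $(G,\le_G)$ and let $A,B\in\mathrm{P}_{\mathrm{fe}}^*(G)$. (1) If $A+B\vdash b$ for every $b\in B$, then $A\vdash 0$. (2) $A\vdash B$ holds if and only if $A-B\vdash0$, if and only if $0\vdash B-A$.
   Context: Groups are commutative; an ordered group is a commutative group with a partial order $\le_G$ compatible with addition. $\mathrm{P}_{\mathrm{fe}}^*(G)$ is the set of nonempty finite subsets of $G$; $a$ stands for $\{a\}$, $A,A'$ for $A\cup A'$, $x+A=\{x+a\}$, $A+B=\{a+b:a\in A,b\in B\}$, $A-B=\{a-b:a\in A,b\in B\}$. An unbounded entailment relation on $G$ is a relation $\vdash$ on $\mathrm{P}_{\mathrm{fe}}^*(G)$ with $a\vdash a$; $A\vdash B\Rightarrow A,A'\vdash B,B'$; ($A\vdash B,c$ and $A,c\vdash B$) $\Rightarrow A\vdash B$. It is regular if moreover $a\le_G b\Rightarrow a\vdash b$; $A\vdash B\Rightarrow x+A\vdash x+B$ for all $x\in G$; and $x+a,y+b\vdash y+a,x+b$ for all $a,b,x,y\in G$. -}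

module Defs where

open import Level using (Level; _⊔_; suc)
open import Algebra.Structures using (IsAbelianGroup)
open import Relation.Binary.Structures using (IsPartialOrder)
open import Relation.Binary.PropositionalEquality using (_≡_)
open import Data.List as List using (List)
open import Data.List.NonEmpty as L⁺ using (List⁺; [_]; _∷_; _⁺++⁺_; toList)
open import Data.List.Membership.Propositional using (_∈_)
open import Data.List.Relation.Binary.Subset.Propositional using (_⊆_)

record OrderedGroup (c ℓ : Level) : Set (suc (c ⊔ ℓ)) where
  infixl 6 _+_ _-_
  infix  4 _≤_
  field
    Carrier        : Set c
    _+_            : Carrier → Carrier → Carrier
    0#             : Carrier
    -_             : Carrier → Carrier
    _≤_            : Carrier → Carrier → Set ℓ
    isAbelianGroup : IsAbelianGroup _≡_ _+_ 0# -_
    isPartialOrder : IsPartialOrder _≡_ _≤_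
    +-mono-≤       : ∀ {a b} (x : Carrier) → a ≤ b → x + a ≤ x + b

  _-_ : Carrier → Carrier → Carrier
  a - b = a + (- b)

module FiniteSubsets {c ℓ : Level} (G : OrderedGroup c ℓ) where
  open OrderedGroup G

  -- Nonempty finite subsets of G, represented by nonempty lists;
  -- entailment relations are required to depend only on the underlying sets.
  Pfe : Set c
  Pfe = List⁺ Carrier

  _∈ₛ_ : Carrier → Pfe → Set c
  a ∈ₛ A = a ∈ toList A

  _⊆ₛ_ : Pfe → Pfe → Set c
  A ⊆ₛ B = toList A ⊆ toList B

  _,ₛ_ : Pfe → Pfe → Pfe
  A ,ₛ B = A ⁺++⁺ B

  _+ₗ_ : Carrier → Pfe → Pfe
  x +ₗ A = L⁺.map (x +_) A

  _⊕_ : Pfe → Pfe → Pfe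
  A ⊕ B = L⁺.concatMap (λ a → L⁺.map (a +_) B) A

  _⊖_ : Pfe → Pfe → Pfe
  A ⊖ B = L⁺.concatMap (λ a → L⁺.map (λ b → a - b) B) A

  -- Weakening is stated for arbitrary
  -- supersets, which both expresses  A ⊢ B ⇒ A,A' ⊢ B,B'  and makes the relation
  -- depend only on the sets represented by the lists.
  record IsEntailment {r : Level} (_⊢_ : Pfe → Pfe → Set r) : Set (c ⊔ r) where
    field
      refl-⊢ : ∀ a → [ a ] ⊢ [ a ]
      mono-⊢ : ∀ {A A₁ B B₁} → A ⊆ₛ A₁ → B ⊆ₛ B₁ → A ⊢ B → A₁ ⊢ B₁
      cut-⊢  : ∀ {A B} c → A ⊢ (B ,ₛ [ c ]) → (A ,ₛ [ c ]) ⊢ B → A ⊢ B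

  record IsRegularEntailment {r : Level} (_⊢_ : Pfe → Pfe → Set r)
      : Set (c ⊔ ℓ ⊔ r) where
    field
      isEntailment : IsEntailment _⊢_
      ≤⇒⊢         : ∀ {a b} → a ≤ b → [ a ] ⊢ [ b ]
      translate-⊢  : ∀ {A B} x → A ⊢ B → (x +ₗ A) ⊢ (x +ₗ B)
      swap-⊢       : ∀ a b x y →
                     ((x + a) ∷ (y + b List.∷ List.[])) ⊢ ((y + a) ∷ (x + b List.∷ List.[]))
    open IsEntailment isEntailment public

-- Everything rests on a cancellation law: if C + L ⊢ x + E for every x ∈ C, then L ⊢ E.
-- For C = {b} this is translation by -b.  Otherwise take two elements b, c of C and put
-- d = b - c.  Since b + l = c + (d + l), the hypothesis survives replacing C by C ∖ {b}
-- and L by L ∪ (d + L), so by induction L ∪ (d + L) ⊢ E; each added point d + l is then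
-- cut away, because by the swap axiom the elements of c + L can be traded on the left
-- against d + (x + l) on the right, which turns the hypothesis for C into the one for
-- C ∖ {c} with E ∪ {d + l}.  Part (1) is the cancellation law for C = B; part (2) is the
-- cancellation law for C = A and C = -B, and for C = B - A applied to the converse relation.

module Submission where

open import Defs
open import Level using (Level; _⊔_)
open import Algebra.Bundles using (AbelianGroup)
open import Data.List as List using ([]; _∷_; _++_; cartesianProductWith)
open import Data.List.NonEmpty as L⁺ using ([_]; _∷_; toList)
open import Data.List.Membership.Propositional using (_∈_)
open import Data.List.Membership.Propositional.Properties
  using (∈-map⁺; ∈-map⁻; ∈-++⁺ˡ; ∈-++⁺ʳ; ∈-cartesianProductWith⁺; ∈-cartesianProductWith⁻)
open import Data.List.Properties using (++-identityʳ; ++-assoc; map-++)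
open import Data.List.Relation.Binary.Subset.Propositional using (_⊆_)
open import Data.List.Relation.Binary.Subset.Propositional.Properties
  using (⊆-refl; ⊆-reflexive; xs⊆xs++ys)
open import Data.List.Relation.Unary.Any using (here; there)
open import Data.Product using (_×_; _,_; ∃₂)
open import Function.Base using (flip; _∘_)
open import Function.Bundles using (_⇔_; mk⇔)
open import Relation.Binary.PropositionalEquality
  using (_≡_; refl; sym; trans; cong; subst; module ≡-Reasoning)

module Entailments {c ℓ : Level} (G : OrderedGroup c ℓ) where
  open OrderedGroup G
  open FiniteSubsets G

  abelianGroup : AbelianGroup c c
  abelianGroup = record
    { Carrier = Carrier ; _≈_ = _≡_ ; _∙_ = _+_ ; ε = 0# ; _⁻¹ = -_
    ; isAbelianGroup = isAbelianGroup }

  open AbelianGroup abelianGroup using (assoc; comm; identityʳ; inverseˡ; inverseʳ)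
  open import Algebra.Properties.AbelianGroup abelianGroup
    using (\\-leftDividesˡ; \\-leftDividesʳ; ⁻¹-anti-homo‿-)
  open import Algebra.Properties.CommutativeSemigroup
    (AbelianGroup.commutativeSemigroup abelianGroup) using (x∙yz≈yx∙z; x∙yz≈y∙xz)
  open ≡-Reasoning

  x+[y-x]≡y : ∀ x y → x + (y - x) ≡ y
  x+[y-x]≡y x y = trans (cong (x +_) (comm y (- x))) (\\-leftDividesˡ x y)

  [x-y]+[y-x]≡0 : ∀ x y → (x - y) + (y - x) ≡ 0#
  [x-y]+[y-x]≡0 x y = trans (cong ((x - y) +_) (sym (⁻¹-anti-homo‿- x y))) (inverseʳ (x - y))

  toList-pairwise : ∀ (f : Carrier → Carrier → Carrier) A B →
    toList (L⁺.concatMap (λ a → L⁺.map (f a) B) A) ≡ cartesianProductWith f (toList A) (toList B)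
  toList-pairwise f (a ∷ as) B = cong (List.map (f a) (toList B) ++_) (tail as)
    where
    tail : ∀ as → List.concat (List.map toList (List.map (λ a → L⁺.map (f a) B) as))
                  ≡ cartesianProductWith f as (toList B)
    tail []       = refl
    tail (a ∷ as) = cong (List.map (f a) (toList B) ++_) (tail as)

  ∈-⊕⁺ : ∀ A B {a b} → a ∈ₛ A → b ∈ₛ B → (a + b) ∈ₛ (A ⊕ B)
  ∈-⊕⁺ A B {a} {b} a∈ b∈ =
    subst ((a + b) ∈_) (sym (toList-pairwise _+_ A B)) (∈-cartesianProductWith⁺ _+_ a∈ b∈)

  ∈-⊕⁻ : ∀ A B {x} → x ∈ₛ (A ⊕ B) → ∃₂ λ a b → a ∈ₛ A × b ∈ₛ B × x ≡ a + b
  ∈-⊕⁻ A B {x} x∈ = ∈-cartesianProductWith⁻ _+_ (toList A) (toList B)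
    (subst (x ∈_) (toList-pairwise _+_ A B) x∈)

  ∈-⊖⁺ : ∀ A B {a b} → a ∈ₛ A → b ∈ₛ B → (a - b) ∈ₛ (A ⊖ B)
  ∈-⊖⁺ A B {a} {b} a∈ b∈ =
    subst ((a - b) ∈_) (sym (toList-pairwise _-_ A B)) (∈-cartesianProductWith⁺ _-_ a∈ b∈)

  ∈-⊖⁻ : ∀ A B {x} → x ∈ₛ (A ⊖ B) → ∃₂ λ a b → a ∈ₛ A × b ∈ₛ B × x ≡ a - b
  ∈-⊖⁻ A B {x} x∈ = ∈-cartesianProductWith⁻ _-_ (toList A) (toList B)
    (subst (x ∈_) (toList-pairwise _-_ A B) x∈)

  +ₗ⊆⊕ : ∀ {a} A B → a ∈ₛ A → (a +ₗ B) ⊆ₛ (A ⊕ B)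
  +ₗ⊆⊕ A B a∈ x∈ with b , b∈ , refl ← ∈-map⁻ _ x∈ = ∈-⊕⁺ A B a∈ b∈

  ⊕-comm-⊆ : ∀ A B → (A ⊕ B) ⊆ₛ (B ⊕ A)
  ⊕-comm-⊆ A B x∈ with a , b , a∈ , b∈ , refl ← ∈-⊕⁻ A B x∈ =
    subst (_∈ₛ (B ⊕ A)) (comm b a) (∈-⊕⁺ B A b∈ a∈)

  ⊆⊕0 : ∀ A → A ⊆ₛ (A ⊕ [ 0# ])
  ⊆⊕0 A {x} x∈ = subst (_∈ₛ (A ⊕ [ 0# ])) (identityʳ x) (∈-⊕⁺ A [ 0# ] x∈ (here refl))

  -- A regular entailment without the order axiom ≤⇒⊢; unlike regularity this notion is
  -- closed under taking the converse relation.
  record IsInvariantEntailment {r : Level} (_⊢_ : Pfe → Pfe → Set r) : Set (c ⊔ r) where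
    field
      isEntailment : IsEntailment _⊢_
      translate-⊢  : ∀ {A B} x → A ⊢ B → (x +ₗ A) ⊢ (x +ₗ B)
      swap-⊢       : ∀ a b x y → ((x + a) ∷ (y + b) ∷ []) ⊢ ((y + a) ∷ (x + b) ∷ [])
    open IsEntailment isEntailment public

  regular⇒invariant : ∀ {r} {_⊢_ : Pfe → Pfe → Set r} →
                      IsRegularEntailment _⊢_ → IsInvariantEntailment _⊢_
  regular⇒invariant regular = record
    { isEntailment = isEntailment ; translate-⊢ = translate-⊢ ; swap-⊢ = swap-⊢ }
    where open IsRegularEntailment regular

  invariant-flip : ∀ {r} {_⊢_ : Pfe → Pfe → Set r} →
                   IsInvariantEntailment _⊢_ → IsInvariantEntailment (flip _⊢_)
  invariant-flip inv = record
    { isEntailment = record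
      { refl-⊢ = refl-⊢
      ; mono-⊢ = λ A⊆ B⊆ → mono-⊢ B⊆ A⊆
      ; cut-⊢  = λ c ⊣c c⊣ → cut-⊢ c c⊣ ⊣c
      }
    ; translate-⊢ = translate-⊢
    ; swap-⊢      = λ a b x y → swap-⊢ a b y x
    }
    where open IsInvariantEntailment inv

  module Cancellation {r} {_⊢_ : Pfe → Pfe → Set r} (inv : IsInvariantEntailment _⊢_) where
    open IsInvariantEntailment inv

    untranslate-⊢ : ∀ x {A B} → (x +ₗ A) ⊢ (x +ₗ B) → A ⊢ B
    untranslate-⊢ x p = mono-⊢ -x+x+⊆ -x+x+⊆ (translate-⊢ (- x) p)
      where
      -x+x+⊆ : ∀ {A} → ((- x) +ₗ (x +ₗ A)) ⊆ₛ A
      -x+x+⊆ {A} y∈ with _ , x+a∈ , refl ← ∈-map⁻ _ y∈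
                   with a , a∈ , refl ← ∈-map⁻ _ x+a∈ = subst (_∈ₛ A) (sym (\\-leftDividesʳ x a)) a∈

    cut-all-⊢ : ∀ {Γ Δ} S → (∀ {s} → s ∈ₛ S → Γ ⊢ (Δ ,ₛ [ s ])) → (Γ ,ₛ S) ⊢ Δ → Γ ⊢ Δ
    cut-all-⊢ {Δ = Δ} S = cut-list (toList S)  -- Γ ,ₛ S is definitionally Γ ⁺++ toList S
      where
      cut-list : ∀ {Γ} ss → (∀ {s} → s ∈ ss → Γ ⊢ (Δ ,ₛ [ s ])) → (Γ L⁺.⁺++ ss) ⊢ Δ → Γ ⊢ Δ
      cut-list {Γ} [] _ p = mono-⊢ (⊆-reflexive (++-identityʳ (toList Γ))) ⊆-refl p
      cut-list {Γ} (s ∷ ss) h p = cut-⊢ s (h (here refl)) (cut-list ss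
        (mono-⊢ (xs⊆xs++ys _ _) ⊆-refl ∘ h ∘ there)
        (mono-⊢ (⊆-reflexive (sym (++-assoc (toList Γ) (s ∷ []) ss))) ⊆-refl p))

    trade-⊢ : ∀ {Γ Δ L b c q} → (b +ₗ L) ⊆ₛ Γ → q ∈ₛ Γ → (Γ ,ₛ (c +ₗ L)) ⊢ Δ →
              Γ ⊢ (Δ ,ₛ [ ((- c) + b) + q ])
    trade-⊢ {Γ} {Δ} {L} {b} {c} {q} b+L⊆Γ q∈Γ p =
      cut-all-⊢ (c +ₗ L) swap-out (mono-⊢ ⊆-refl (xs⊆xs++ys _ _) p)
      where
      swap-out : ∀ {s} → s ∈ₛ (c +ₗ L) → Γ ⊢ ((Δ ,ₛ [ ((- c) + b) + q ]) ,ₛ [ s ])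
      swap-out s∈ with l , l∈ , refl ← ∈-map⁻ _ s∈ = mono-⊢ left right (swap-⊢ l ((- c) + q) b c)
        where
        left : ((b + l) ∷ (c + ((- c) + q)) ∷ []) ⊆ toList Γ
        left (here refl)         = b+L⊆Γ (∈-map⁺ (b +_) l∈)
        left (there (here refl)) = subst (_∈ₛ Γ) (sym (\\-leftDividesˡ c q)) q∈Γ
        right : ((c + l) ∷ (b + ((- c) + q)) ∷ []) ⊆ toList ((Δ ,ₛ [ ((- c) + b) + q ]) ,ₛ [ c + l ])
        right (here refl)         = ∈-++⁺ʳ (toList (Δ ,ₛ [ ((- c) + b) + q ])) (here refl)
        right (there (here refl)) = ∈-++⁺ˡ (∈-++⁺ʳ (toList Δ) (here (x∙yz≈yx∙z b (- c) q)))

    cancel-∷ : ∀ b bs {L E} → (∀ {x} → x ∈ (b ∷ bs) → ((b ∷ bs) ⊕ L) ⊢ (x +ₗ E)) → L ⊢ E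
    cancel-∷ b [] {L} h = untranslate-⊢ b (mono-⊢ [b]⊕L⊆b+L ⊆-refl (h (here refl)))
      where
      [b]⊕L⊆b+L : ([ b ] ⊕ L) ⊆ₛ (b +ₗ L)
      [b]⊕L⊆b+L = ⊆-reflexive (++-identityʳ (toList (b +ₗ L)))
    cancel-∷ b (c ∷ bs) {L} {E} h =
      cut-all-⊢ (d +ₗ L) cut-d+L (cancel-∷ c bs (mono-⊢ absorb ⊆-refl ∘ h ∘ there))
      where
      d = (- c) + b

      c+[d+l]≡b+l : ∀ l → c + (d + l) ≡ b + l
      c+[d+l]≡b+l l = begin
        c + (d + l)  ≡⟨ assoc c d l ⟨
        (c + d) + l  ≡⟨ cong (_+ l) (\\-leftDividesˡ c b) ⟩
        b + l        ∎

      absorb : ((b ∷ c ∷ bs) ⊕ L) ⊆ₛ ((c ∷ bs) ⊕ (L ,ₛ (d +ₗ L)))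
      absorb x∈ with ∈-⊕⁻ (b ∷ c ∷ bs) L x∈
      ... | _ , l , here refl , l∈ , refl =
        subst (_∈ₛ ((c ∷ bs) ⊕ (L ,ₛ (d +ₗ L)))) (c+[d+l]≡b+l l) (∈-⊕⁺ (c ∷ bs) (L ,ₛ (d +ₗ L)) (here refl) (∈-++⁺ʳ (toList L) (∈-map⁺ (d +_) l∈)))
      ... | _ , l , there a∈ , l∈ , refl = ∈-⊕⁺ (c ∷ bs) (L ,ₛ (d +ₗ L)) a∈ (∈-++⁺ˡ l∈)

      split : ((b ∷ c ∷ bs) ⊕ L) ⊆ₛ (((b ∷ bs) ⊕ L) ,ₛ (c +ₗ L))
      split x∈ with ∈-⊕⁻ (b ∷ c ∷ bs) L x∈
      ... | _ , l , here refl , l∈ , refl          = ∈-++⁺ˡ (∈-⊕⁺ (b ∷ bs) L (here refl) l∈)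
      ... | _ , l , there (here refl) , l∈ , refl  = ∈-++⁺ʳ (toList ((b ∷ bs) ⊕ L)) (∈-map⁺ (c +_) l∈)
      ... | _ , l , there (there a∈) , l∈ , refl   = ∈-++⁺ˡ (∈-⊕⁺ (b ∷ bs) L (there a∈) l∈)

      skip-c : ∀ {x} → x ∈ (b ∷ bs) → x ∈ (b ∷ c ∷ bs)
      skip-c (here x≡b) = here x≡b
      skip-c (there x∈) = there (there x∈)

      cut-d+L : ∀ {s} → s ∈ₛ (d +ₗ L) → L ⊢ (E ,ₛ [ s ])
      cut-d+L s∈ with l , l∈ , refl ← ∈-map⁻ _ s∈ = cancel-∷ b bs λ {x} x∈ →
        mono-⊢ ⊆-refl (regroup x)
          (trade-⊢ (+ₗ⊆⊕ (b ∷ bs) L (here refl)) (∈-⊕⁺ (b ∷ bs) L x∈ l∈) (mono-⊢ split ⊆-refl (h (skip-c x∈))))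
        where
        regroup : ∀ x → ((x +ₗ E) ,ₛ [ d + (x + l) ]) ⊆ₛ (x +ₗ (E ,ₛ [ d + l ]))
        regroup x = ⊆-reflexive (trans
          (cong (λ y → toList (x +ₗ E) ++ y ∷ []) (x∙yz≈y∙xz d x l))
          (sym (map-++ (x +_) (toList E) List.[ d + l ])))

    cancel-⊢ : ∀ C {L E} → (∀ {x} → x ∈ₛ C → (C ⊕ L) ⊢ (x +ₗ E)) → L ⊢ E
    cancel-⊢ (b ∷ bs) = cancel-∷ b bs

  module Consequences {r} {_⊢_ : Pfe → Pfe → Set r} (inv : IsInvariantEntailment _⊢_) where
    open IsInvariantEntailment inv using (mono-⊢)
    open Cancellation inv using (cancel-⊢)
    open Cancellation (invariant-flip inv) using () renaming (cancel-⊢ to cancel-⊣)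

    ⊕⊢⇒⊢0 : ∀ A B → (∀ b → b ∈ₛ B → (A ⊕ B) ⊢ [ b ]) → A ⊢ [ 0# ]
    ⊕⊢⇒⊢0 A B h = cancel-⊢ B λ {b} b∈ → mono-⊢ (⊕-comm-⊆ A B) (b⊆b+0 b) (h b b∈)
      where
      b⊆b+0 : ∀ b → [ b ] ⊆ₛ (b +ₗ [ 0# ])
      b⊆b+0 b (here refl) = here (sym (identityʳ b))

    ⊢⇒0⊢⊖ : ∀ A B → A ⊢ B → [ 0# ] ⊢ (B ⊖ A)
    ⊢⇒0⊢⊖ A B p = cancel-⊢ A λ a∈ → mono-⊢ (⊆⊕0 A) (B⊆a+[B⊖A] a∈) p
      where
      B⊆a+[B⊖A] : ∀ {a} → a ∈ₛ A → B ⊆ₛ (a +ₗ (B ⊖ A))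
      B⊆a+[B⊖A] {a} a∈ {b} b∈ =
        subst (_∈ₛ (a +ₗ (B ⊖ A))) (x+[y-x]≡y a b) (∈-map⁺ (a +_) (∈-⊖⁺ B A b∈ a∈))

    0⊢⊖⇒⊖⊢0 : ∀ A B → [ 0# ] ⊢ (B ⊖ A) → (A ⊖ B) ⊢ [ 0# ]
    0⊢⊖⇒⊖⊢0 A B p = cancel-⊣ (B ⊖ A) λ x∈ → mono-⊢ (0⊆x+[A⊖B] x∈) (⊆⊕0 (B ⊖ A)) p
      where
      0⊆x+[A⊖B] : ∀ {x} → x ∈ₛ (B ⊖ A) → [ 0# ] ⊆ₛ (x +ₗ (A ⊖ B))
      0⊆x+[A⊖B] x∈ (here refl) with b , a , b∈ , a∈ , refl ← ∈-⊖⁻ B A x∈ =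
        subst (_∈ₛ ((b - a) +ₗ (A ⊖ B))) ([x-y]+[y-x]≡0 b a)
          (∈-map⁺ ((b - a) +_) (∈-⊖⁺ A B a∈ b∈))

    ⊖⊢0⇒⊢ : ∀ A B → (A ⊖ B) ⊢ [ 0# ] → A ⊢ B
    ⊖⊢0⇒⊢ A B p = cancel-⊢ -B λ x∈ → mono-⊢ A⊖B⊆-B⊕A (0⊆x+B x∈) p
      where
      -B = L⁺.map -_ B
      A⊖B⊆-B⊕A : (A ⊖ B) ⊆ₛ (-B ⊕ A)
      A⊖B⊆-B⊕A x∈ with a , b , a∈ , b∈ , refl ← ∈-⊖⁻ A B x∈ =
        subst (_∈ₛ (-B ⊕ A)) (comm (- b) a) (∈-⊕⁺ -B A (∈-map⁺ -_ b∈) a∈)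
      0⊆x+B : ∀ {x} → x ∈ₛ -B → [ 0# ] ⊆ₛ (x +ₗ B)
      0⊆x+B x∈ (here refl) with b , b∈ , refl ← ∈-map⁻ _ x∈ =
        subst (_∈ₛ ((- b) +ₗ B)) (inverseˡ b) (∈-map⁺ ((- b) +_) b∈)

corollary2p12 : {c ℓ r : Level} (G : OrderedGroup c ℓ) →
    (_⊢_ : FiniteSubsets.Pfe G → FiniteSubsets.Pfe G → Set r) →
    FiniteSubsets.IsRegularEntailment G _⊢_ →
    (A B : FiniteSubsets.Pfe G) →
    ((∀ b → FiniteSubsets._∈ₛ_ G b B → FiniteSubsets._⊕_ G A B ⊢ [ b ]) →
      A ⊢ [ OrderedGroup.0# G ])
    × ((A ⊢ B ⇔ FiniteSubsets._⊖_ G A B ⊢ [ OrderedGroup.0# G ])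
       × (FiniteSubsets._⊖_ G A B ⊢ [ OrderedGroup.0# G ]
          ⇔ [ OrderedGroup.0# G ] ⊢ FiniteSubsets._⊖_ G B A))
corollary2p12 G _⊢_ regular A B =
    ⊕⊢⇒⊢0 A B
  , mk⇔ (0⊢⊖⇒⊖⊢0 A B ∘ ⊢⇒0⊢⊖ A B) (⊖⊢0⇒⊢ A B)
  , mk⇔ (⊢⇒0⊢⊖ A B ∘ ⊖⊢0⇒⊢ A B) (0⊢⊖⇒⊖⊢0 A B)
  where open Entailments G using (module Consequences; regular⇒invariant)
        open Consequences (regular⇒invariant regular)
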